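{- Let $G$ be a finite group. Then $l(G) \leq \log_2(|G|)$; in particular $l(G)<\infty$.
   Context: For a profinite group $G$, the generalized derived subgroup $D(G)$ is the intersection of all open normal subgroups $N$ of $G$ such that $G/N$ is either abelian or simple. The generalized derived series is $G^{(0)}=G$, $G^{(i+1)}=D(G^{(i)})$. The abelian-simple length $l(G)$ is the smallest integer $l\ge 0$ with $G^{(l)}=1$, and $l(G)=\infty$ if no such $l$ exists. -}

module Defs where

open import Data.Nat using (ℕ; zero; suc)
open import Data.Fin using (Fin)
open import Data.Fin.Subset using (Subset; _∈_; _∉_; _⊆_)
open import Data.Product using (Σ; ∃; ∃-syntax; _×_; _,_)
open import Data.Sum using (_⊎_)
open import Function.Bundles using (_⇔_)
open import Relation.Binary.PropositionalEquality using (_≡_)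

-- A finite group of order n, presented (up to isomorphism) with carrier Fin n.
record FiniteGroup : Set where
  field
    n     : ℕ
    _·_   : Fin n → Fin n → Fin n
    e     : Fin n
    inv   : Fin n → Fin n
    assoc : ∀ x y z → (x · y) · z ≡ x · (y · z)
    idˡ   : ∀ x → e · x ≡ x
    idʳ   : ∀ x → x · e ≡ x
    invˡ  : ∀ x → inv x · x ≡ e
    invʳ  : ∀ x → x · inv x ≡ e

module _ (G : FiniteGroup) where
  open FiniteGroup G

  order : ℕ
  order = n

  IsSubgroup : Subset n → Set
  IsSubgroup K = (e ∈ K) × (∀ {x y} → x ∈ K → y ∈ K → (x · y) ∈ K)
                 × (∀ {x} → x ∈ K → inv x ∈ K)

  IsNormalSubgroupOf : Subset n → Subset n → Set
  IsNormalSubgroupOf N H = IsSubgroup N × (N ⊆ H)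
    × (∀ {h x} → h ∈ H → x ∈ N → ((h · x) · inv h) ∈ N)

  -- H/N is abelian (N normal in H): all commutators of H lie in N
  QuotientAbelian : Subset n → Subset n → Set
  QuotientAbelian H N = ∀ {x y} → x ∈ H → y ∈ H → (((x · y) · inv x) · inv y) ∈ N

  -- H/N is simple (N normal in H): H/N is nontrivial and, via the
  -- correspondence theorem, there is no normal subgroup of H strictly
  -- between N and H
  QuotientSimple : Subset n → Subset n → Set
  QuotientSimple H N = (∃[ h ] (h ∈ H × h ∉ N))
    × (∀ M → IsNormalSubgroupOf M H → N ⊆ M → (M ⊆ N) ⊎ (H ⊆ M))

  -- membership in D(H): intersection of all (open) normal subgroups N of H
  -- with H/N abelian or simple (every subgroup of a finite group is open)
  InD : Subset n → Fin n → Set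
  InD H x = ∀ N → IsNormalSubgroupOf N H
              → (QuotientAbelian H N ⊎ QuotientSimple H N) → x ∈ N

  IsGenDerivedSeries : (ℕ → Subset n) → Set
  IsGenDerivedSeries S = (∀ x → x ∈ S zero)
    × (∀ i x → (x ∈ S (suc i)) ⇔ InD (S i) x)

  IsTrivial : Subset n → Set
  IsTrivial K = ∀ x → (x ∈ K) ⇔ (x ≡ e)

  -- G^(l) = 1, i.e. l(G) ≤ l
  DerivedTermTrivial : ℕ → Set
  DerivedTermTrivial l = ∃[ S ] (IsGenDerivedSeries S × IsTrivial (S l))

{-# OPTIONS --safe #-}
module Submission where

open import Defs
open import Data.Bool using (true)
open import Data.Empty using (⊥-elim)
open import Data.Fin using (Fin; _≟_)
open import Data.Fin.Properties using (any?; all?)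
open import Data.Fin.Subset
  using (Subset; inside; outside; _∈_; _∉_; _⊆_; _⊂_; _⊃_; _─_; _-_; ⁅_⁆; ⊤; ∣_∣)
open import Data.Fin.Subset.Induction using (⊂-wellFounded; ⊃-wellFounded)
open import Data.Fin.Subset.Properties
  using ( _∈?_; _⊆?_; _⊂?_; anySubset?; nonempty?; Empty-unique; ∣⊥∣≡0; ∣⊤∣≡n; ∈⊤
        ; ⊆-trans; drop-∷-⊆; p─⊥≡p; p─q⊆p; p⊆q⇒∣p∣≤∣q∣; x∈⁅x⁆; x∈⁅y⁆⇒x≡y
        ; x∈p∧x≢y⇒x∈p-y; x∈p⇒p-x⊂p; x∈p⇒∣p-x∣<∣p∣)
open import Data.Nat using (ℕ; zero; suc; _+_; _*_; _^_; _≤_; _<_; _>_; z≤n; s≤s)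
open import Data.Nat.Logarithm using (⌊log₂_⌋; ⌊log₂⌋-mono-≤; ⌊log₂[2^n]⌋≡n)
open import Data.Nat.Properties
  using ( ≤-trans; ≤-reflexive; <⇒≱; m≤n⇒m≤1+n; +-identityʳ; +-suc; *-identityʳ
        ; *-assoc; *-distribˡ-+; +-mono-≤; +-monoʳ-≤; +-mono-≤-<; *-monoʳ-≤; m^n>0
        ; module ≤-Reasoning)
open import Data.Product using (∃-syntax; _×_; _,_; proj₁)
open import Data.Sum using (_⊎_; inj₁; inj₂)
open import Data.Vec using (_∷_; []; tabulate; here; there)
open import Data.Vec.Properties using (lookup∘tabulate; []=⇒lookup; lookup⇒[]=)
open import Function using (_∘_; id)
open import Function.Bundles using (_⇔_; mk⇔; Equivalence)
open import Function.Definitions using (Injective)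
open import Induction.WellFounded using (Acc; acc)
open import Relation.Binary.PropositionalEquality
open import Relation.Nullary using (¬_; Dec; yes; no; does; ¬?; _×-dec_; _⊎-dec_; _→-dec_)
open import Relation.Nullary.Decidable using (decidable-stable; dec-true; map′)
open import Relation.Unary using (Pred; Decidable)

-- A nontrivial term H of the generalized derived series has a maximal proper
-- normal subgroup N; then H/N is simple, so D(H) ⊆ N.  A proper subgroup is
-- disjoint from one of its cosets, hence has at most half the elements of H.
-- So |G^(i)| ≤ |G| / 2^i for as long as G^(i) is nontrivial, which forces
-- G^(l) = 1 for some l with 2^l ≤ |G|.

n<2^n : ∀ n → n < 2 ^ n
n<2^n zero = s≤s z≤n
n<2^n (suc n) = subst (suc n <_) (cong (2 ^ n +_) (sym (+-identityʳ (2 ^ n))))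
  (+-mono-≤-< (m^n>0 2 n) (n<2^n n))

2^l≤m⇒l≤⌊log₂m⌋ : ∀ {l m} → 2 ^ l ≤ m → l ≤ ⌊log₂ m ⌋
2^l≤m⇒l≤⌊log₂m⌋ {l} 2^l≤m = subst (_≤ _) (⌊log₂[2^n]⌋≡n l) (⌊log₂⌋-mono-≤ 2^l≤m)

x∈p─q⇒x∉q : ∀ {n} {p q : Subset n} {x} → x ∈ p ─ q → x ∉ q
x∈p─q⇒x∉q {p = _ ∷ _} {_ ∷ _} (there x∈p─q) (there x∈q) = x∈p─q⇒x∉q x∈p─q x∈q

x∈p⇒∣p∣≡1+∣p-x∣ : ∀ {n} {p : Subset n} {x} → x ∈ p → ∣ p ∣ ≡ suc ∣ p - x ∣
x∈p⇒∣p∣≡1+∣p-x∣ {p = inside ∷ p} here = cong (suc ∘ ∣_∣) (sym (p─⊥≡p p))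
x∈p⇒∣p∣≡1+∣p-x∣ {p = outside ∷ _} (there x∈p) = x∈p⇒∣p∣≡1+∣p-x∣ x∈p
x∈p⇒∣p∣≡1+∣p-x∣ {p = inside ∷ _} (there x∈p) = cong suc (x∈p⇒∣p∣≡1+∣p-x∣ x∈p)

x∈p⇒∣p∣>0 : ∀ {n} {p : Subset n} {x} → x ∈ p → ∣ p ∣ > 0
x∈p⇒∣p∣>0 x∈p = ≤-trans (s≤s z≤n) (x∈p⇒∣p-x∣<∣p∣ x∈p)

p⊈q⇒∃∈∉ : ∀ {n} {p q : Subset n} → ¬ (p ⊆ q) → ∃[ x ] (x ∈ p × x ∉ q)
p⊈q⇒∃∈∉ {p = p} {q} p⊈q with any? (λ x → (x ∈? p) ×-dec ¬? (x ∈? q))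
... | yes found = found
... | no none = ⊥-elim (p⊈q λ {x} x∈p →
        decidable-stable (x ∈? q) (λ x∉q → none (x , x∈p , x∉q)))

allSubset? : ∀ {n} {ℓ} {P : Pred (Subset n) ℓ} → Decidable P → Dec (∀ p → P p)
allSubset? P? with anySubset? (¬? ∘ P?)
... | yes (p , ¬Pp) = no (λ ∀P → ¬Pp (∀P p))
... | no ¬∃ = yes (λ p → decidable-stable (P? p) (λ ¬Pp → ¬∃ (p , ¬Pp)))

fromDec : ∀ {n} {ℓ} {P : Pred (Fin n) ℓ} → Decidable P → Subset n
fromDec P? = tabulate (does ∘ P?)

∈-fromDec : ∀ {n} {ℓ} {P : Pred (Fin n) ℓ} (P? : Decidable P) x → x ∈ fromDec P? ⇔ P x
∈-fromDec {P = P} P? x = mk⇔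
  (λ x∈ → does⇒ (P? x) (trans (sym (lookup∘tabulate _ x)) ([]=⇒lookup x∈)))
  (λ Px → lookup⇒[]= x _ (trans (lookup∘tabulate _ x) (dec-true (P? x) Px)))
  where
  does⇒ : (Px? : Dec (P x)) → does Px? ≡ true → P x
  does⇒ (yes Px) _ = Px

disjoint⇒∣p∣+∣q∣≤∣r∣ : ∀ {n} {p q r : Subset n} → (∀ {x} → x ∈ p → x ∉ q) →
                      p ⊆ r → q ⊆ r → ∣ p ∣ + ∣ q ∣ ≤ ∣ r ∣
disjoint⇒∣p∣+∣q∣≤∣r∣ {p = []} {[]} {[]} _ _ _ = z≤n
disjoint⇒∣p∣+∣q∣≤∣r∣ {p = _ ∷ _} {_ ∷ _} {_ ∷ _} disj p⊆r q⊆r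
  with disjoint⇒∣p∣+∣q∣≤∣r∣ (λ x∈p x∈q → disj (there x∈p) (there x∈q))
                            (drop-∷-⊆ p⊆r) (drop-∷-⊆ q⊆r)
disjoint⇒∣p∣+∣q∣≤∣r∣ {p = inside ∷ _} {inside ∷ _} disj _ _ | _ = ⊥-elim (disj here here)
disjoint⇒∣p∣+∣q∣≤∣r∣ {p = inside ∷ _} {outside ∷ _} {outside ∷ _} _ p⊆r _ | _ with p⊆r here
... | ()
disjoint⇒∣p∣+∣q∣≤∣r∣ {p = outside ∷ _} {inside ∷ _} {outside ∷ _} _ _ q⊆r | _ with q⊆r here
... | ()
disjoint⇒∣p∣+∣q∣≤∣r∣ {p = inside ∷ _} {outside ∷ _} {inside ∷ _} _ _ _ | ih = s≤s ih
disjoint⇒∣p∣+∣q∣≤∣r∣ {p = outside ∷ p} {inside ∷ q} {inside ∷ r} _ _ _ | ih =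
  subst (_≤ suc ∣ r ∣) (sym (+-suc ∣ p ∣ ∣ q ∣)) (s≤s ih)
disjoint⇒∣p∣+∣q∣≤∣r∣ {p = outside ∷ _} {outside ∷ _} {inside ∷ _} _ _ _ | ih = m≤n⇒m≤1+n ih
disjoint⇒∣p∣+∣q∣≤∣r∣ {p = outside ∷ _} {outside ∷ _} {outside ∷ _} _ _ _ | ih = ih

injective⇒∣p∣≤∣q∣ : ∀ {n m} {f : Fin n → Fin m} → Injective _≡_ _≡_ f →
                    ∀ {p q} → (∀ {x} → x ∈ p → f x ∈ q) → ∣ p ∣ ≤ ∣ q ∣
injective⇒∣p∣≤∣q∣ {n} {f = f} f-inj {p} = go p (⊂-wellFounded p)
  where
  open ≤-Reasoning
  go : ∀ p → Acc _⊂_ p → ∀ {q} → (∀ {x} → x ∈ p → f x ∈ q) → ∣ p ∣ ≤ ∣ q ∣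
  go p (acc rs) {q} p↦q with nonempty? p
  ... | no p-empty =
    subst (_≤ ∣ q ∣) (sym (trans (cong ∣_∣ (Empty-unique p-empty)) (∣⊥∣≡0 n))) z≤n
  ... | yes (x , x∈p) = begin
    ∣ p ∣              ≡⟨ x∈p⇒∣p∣≡1+∣p-x∣ x∈p ⟩
    suc ∣ p - x ∣      ≤⟨ s≤s (go (p - x) (rs (x∈p⇒p-x⊂p x∈p)) p-x↦q-fx) ⟩
    suc ∣ q - f x ∣    ≤⟨ x∈p⇒∣p-x∣<∣p∣ (p↦q x∈p) ⟩
    ∣ q ∣              ∎
    where
    p-x↦q-fx : ∀ {y} → y ∈ p - x → f y ∈ q - f x
    p-x↦q-fx {y} y∈p-x = x∈p∧x≢y⇒x∈p-y (p↦q (p─q⊆p p ⁅ x ⁆ y∈p-x))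
      (λ fy≡fx → x∈p─q⇒x∉q y∈p-x (subst (_∈ ⁅ x ⁆) (sym (f-inj fy≡fx)) (x∈⁅x⁆ x)))

⊂-maximal : ∀ {n} {ℓ} {P : Pred (Subset n) ℓ} → Decidable P → ∀ {p} → P p →
            ∃[ q ] (p ⊆ q × P q × ∀ r → P r → ¬ (q ⊂ r))
⊂-maximal {P = P} P? {p} Pp = go p Pp (⊃-wellFounded p)
  where
  go : ∀ p → P p → Acc _⊃_ p → ∃[ q ] (p ⊆ q × P q × ∀ r → P r → ¬ (q ⊂ r))
  go p Pp (acc rs) with anySubset? (λ r → P? r ×-dec (p ⊂? r))
  ... | no none = p , id , Pp , λ r Pr p⊂r → none (r , Pr , p⊂r)
  ... | yes (r , Pr , p⊂r) with go r Pr (rs p⊂r)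
  ...   | q , r⊆q , Pq , maximal = q , ⊆-trans (proj₁ p⊂r) r⊆q , Pq , maximal

module _ (G : FiniteGroup) where
  open FiniteGroup G

  inv-·-cancel : ∀ h x → inv h · (h · x) ≡ x
  inv-·-cancel h x = trans (sym (assoc _ _ _)) (trans (cong (_· x) (invˡ h)) (idˡ x))

  ·-inv-cancel : ∀ h x → h · (inv h · x) ≡ x
  ·-inv-cancel h x = trans (sym (assoc _ _ _)) (trans (cong (_· x) (invʳ h)) (idˡ x))

  ·-cancelˡ : ∀ h → Injective _≡_ _≡_ (h ·_)
  ·-cancelˡ h {x} {y} hx≡hy =
    trans (sym (inv-·-cancel h x)) (trans (cong (inv h ·_) hx≡hy) (inv-·-cancel h y))

  inv-involutive : ∀ h → inv (inv h) ≡ h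
  inv-involutive h = begin
    inv (inv h)                 ≡⟨ sym (·-inv-cancel h (inv (inv h))) ⟩
    h · (inv h · inv (inv h))   ≡⟨ cong (h ·_) (invʳ (inv h)) ⟩
    h · e                       ≡⟨ idʳ h ⟩
    h                           ∎
    where open ≡-Reasoning

  ∀ⁱ? : {P : Fin n → Set} → Decidable P → Dec (∀ {x} → P x)
  ∀ⁱ? P? = map′ (λ ∀P {x} → ∀P x) (λ ∀P x → ∀P {x}) (all? P?)

  ∀ⁱ²? : {P : Fin n → Fin n → Set} → (∀ x y → Dec (P x y)) → Dec (∀ {x y} → P x y)
  ∀ⁱ²? P? = ∀ⁱ? λ x → ∀ⁱ? (P? x)

  IsSubgroup? : Decidable (IsSubgroup G)
  IsSubgroup? K = (e ∈? K)
    ×-dec ∀ⁱ²? (λ x y → (x ∈? K) →-dec (y ∈? K) →-dec ((x · y) ∈? K))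
    ×-dec ∀ⁱ? (λ x → (x ∈? K) →-dec (inv x ∈? K))

  IsNormalSubgroupOf? : ∀ N H → Dec (IsNormalSubgroupOf G N H)
  IsNormalSubgroupOf? N H = IsSubgroup? N ×-dec (N ⊆? H)
    ×-dec ∀ⁱ²? (λ h x → (h ∈? H) →-dec (x ∈? N) →-dec (((h · x) · inv h) ∈? N))

  QuotientAbelian? : ∀ H N → Dec (QuotientAbelian G H N)
  QuotientAbelian? H N =
    ∀ⁱ²? (λ x y → (x ∈? H) →-dec (y ∈? H) →-dec ((((x · y) · inv x) · inv y) ∈? N))

  QuotientSimple? : ∀ H N → Dec (QuotientSimple G H N)
  QuotientSimple? H N = any? (λ h → (h ∈? H) ×-dec ¬? (h ∈? N))
    ×-dec allSubset? (λ M → IsNormalSubgroupOf? M H →-dec (N ⊆? M)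
                             →-dec ((M ⊆? N) ⊎-dec (H ⊆? M)))

  InD? : ∀ H → Decidable (InD G H)
  InD? H x = allSubset? (λ N → IsNormalSubgroupOf? N H
    →-dec (QuotientAbelian? H N ⊎-dec QuotientSimple? H N) →-dec (x ∈? N))

  ⁅e⁆-normal : ∀ {H} → IsSubgroup G H → IsNormalSubgroupOf G ⁅ e ⁆ H
  ⁅e⁆-normal {H} (e∈H , _ , _) =
      (x∈⁅x⁆ e , (λ x∈ y∈ → ∈⁅e⁆ (trans (cong₂ _·_ (≡e x∈) (≡e y∈)) (idˡ e)))
               , (λ x∈ → ∈⁅e⁆ (trans (cong inv (≡e x∈)) inv-e≡e)))
    , (λ x∈ → subst (_∈ H) (sym (≡e x∈)) e∈H)
    , (λ {h} _ x∈ → ∈⁅e⁆ (trans (cong (λ x → (h · x) · inv h) (≡e x∈))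
                                (trans (cong (_· inv h) (idʳ h)) (invʳ h))))
    where
    ≡e : ∀ {x} → x ∈ ⁅ e ⁆ → x ≡ e
    ≡e = x∈⁅y⁆⇒x≡y e
    ∈⁅e⁆ : ∀ {x} → x ≡ e → x ∈ ⁅ e ⁆
    ∈⁅e⁆ x≡e = subst (_∈ ⁅ e ⁆) (sym x≡e) (x∈⁅x⁆ e)
    inv-e≡e : inv e ≡ e
    inv-e≡e = trans (sym (idˡ (inv e))) (invʳ e)

  trivial-or-nontrivial : ∀ {K} → e ∈ K → IsTrivial G K ⊎ ∃[ x ] (x ∈ K × x ≢ e)
  trivial-or-nontrivial {K} e∈K with any? (λ x → (x ∈? K) ×-dec ¬? (x ≟ e))
  ... | yes nontrivial = inj₂ nontrivial
  ... | no none = inj₁ λ x → mk⇔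
          (λ x∈K → decidable-stable (x ≟ e) (λ x≢e → none (x , x∈K , x≢e)))
          (λ x≡e → subst (_∈ K) (sym x≡e) e∈K)

  nontrivial⇒∃simpleQuotient : ∀ {H x} → IsSubgroup G H → x ∈ H → x ≢ e →
                               ∃[ N ] (IsNormalSubgroupOf G N H × QuotientSimple G H N)
  nontrivial⇒∃simpleQuotient {H} {x} H≤G x∈H x≢e
    with ⊂-maximal (λ M → IsNormalSubgroupOf? M H ×-dec ¬? (H ⊆? M))
                   (⁅e⁆-normal H≤G , λ H⊆⁅e⁆ → x≢e (x∈⁅y⁆⇒x≡y e (H⊆⁅e⁆ x∈H)))
  ... | N , _ , (N⊴H , H⊈N) , maximal = N , N⊴H , p⊈q⇒∃∈∉ H⊈N , intermediate
    where
    intermediate : ∀ M → IsNormalSubgroupOf G M H → N ⊆ M → (M ⊆ N) ⊎ (H ⊆ M)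
    intermediate M M⊴H N⊆M with M ⊆? N | H ⊆? M
    ... | yes M⊆N | _        = inj₁ M⊆N
    ... | no _    | yes H⊆M = inj₂ H⊆M
    ... | no M⊈N  | no H⊈M  = ⊥-elim (maximal M (M⊴H , H⊈M) (N⊆M , p⊈q⇒∃∈∉ M⊈N))

  properSubgroup⇒∣K∣+∣K∣≤∣H∣ : ∀ {K H h} → IsSubgroup G K → IsSubgroup G H → K ⊆ H →
                              h ∈ H → h ∉ K → ∣ K ∣ + ∣ K ∣ ≤ ∣ H ∣
  properSubgroup⇒∣K∣+∣K∣≤∣H∣ {K} {H} {h} (_ , K-· , K-inv) (_ , H-· , _) K⊆H h∈H h∉K =
    ≤-trans (+-monoʳ-≤ ∣ K ∣ ∣K∣≤∣hK∣) (disjoint⇒∣p∣+∣q∣≤∣r∣ K∩hK≡∅ K⊆H hK⊆H)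
    where
    hK : Subset n
    hK = fromDec (λ y → (inv h · y) ∈? K)
    ∈hK : ∀ y → y ∈ hK ⇔ (inv h · y) ∈ K
    ∈hK = ∈-fromDec (λ y → (inv h · y) ∈? K)
    ∣K∣≤∣hK∣ : ∣ K ∣ ≤ ∣ hK ∣
    ∣K∣≤∣hK∣ = injective⇒∣p∣≤∣q∣ (·-cancelˡ h)
      (λ {x} x∈K → Equivalence.from (∈hK (h · x)) (subst (_∈ K) (sym (inv-·-cancel h x)) x∈K))
    hK⊆H : hK ⊆ H
    hK⊆H {y} y∈hK =
      subst (_∈ H) (·-inv-cancel h y) (H-· h∈H (K⊆H (Equivalence.to (∈hK y) y∈hK)))
    K∩hK≡∅ : ∀ {y} → y ∈ K → y ∉ hK
    K∩hK≡∅ {y} y∈K y∈hK = h∉K (subst (_∈ K) (inv-involutive h) (K-inv inv-h∈K))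
      where
      inv-h∈K : inv h ∈ K
      inv-h∈K = subst (_∈ K)
        (trans (assoc _ _ _) (trans (cong (inv h ·_) (invʳ y)) (idʳ _)))
        (K-· (Equivalence.to (∈hK y) y∈hK) (K-inv y∈K))

  D : Subset n → Subset n
  D H = fromDec (InD? H)

  D-subgroup : ∀ H → IsSubgroup G (D H)
  D-subgroup H =
      from (λ { _ ((e∈N , _) , _) _ → e∈N })
    , (λ x∈ y∈ → from λ { N N⊴H@((_ , N-· , _) , _) q → N-· (to x∈ N N⊴H q) (to y∈ N N⊴H q) })
    , (λ x∈ → from λ { N N⊴H@((_ , _ , N-inv) , _) q → N-inv (to x∈ N N⊴H q) })
    where
    to : ∀ {x} → x ∈ D H → InD G H x
    to = Equivalence.to (∈-fromDec (InD? H) _)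
    from : ∀ {x} → InD G H x → x ∈ D H
    from = Equivalence.from (∈-fromDec (InD? H) _)

  D⊆simpleKernel : ∀ {H N} → IsNormalSubgroupOf G N H → QuotientSimple G H N → D H ⊆ N
  D⊆simpleKernel {H} {N} N⊴H simple {x} x∈DH =
    Equivalence.to (∈-fromDec (InD? H) x) x∈DH N N⊴H (inj₂ simple)

  ∣DH∣+∣DH∣≤∣H∣ : ∀ {H x} → IsSubgroup G H → x ∈ H → x ≢ e → ∣ D H ∣ + ∣ D H ∣ ≤ ∣ H ∣
  ∣DH∣+∣DH∣≤∣H∣ {H} H≤G x∈H x≢e with nontrivial⇒∃simpleQuotient H≤G x∈H x≢e
  ... | N , N⊴H@(N≤G , N⊆H , _) , simple@((h , h∈H , h∉N) , _) =
    ≤-trans (+-mono-≤ ∣DH∣≤∣N∣ ∣DH∣≤∣N∣) (properSubgroup⇒∣K∣+∣K∣≤∣H∣ N≤G H≤G N⊆H h∈H h∉N)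
    where
    ∣DH∣≤∣N∣ : ∣ D H ∣ ≤ ∣ N ∣
    ∣DH∣≤∣N∣ = p⊆q⇒∣p∣≤∣q∣ (D⊆simpleKernel N⊴H simple)

  S : ℕ → Subset n
  S zero    = ⊤
  S (suc i) = D (S i)

  S-isGenDerivedSeries : IsGenDerivedSeries G S
  S-isGenDerivedSeries = (λ _ → ∈⊤) , (λ i → ∈-fromDec (InD? (S i)))

  S-subgroup : ∀ i → IsSubgroup G (S i)
  S-subgroup zero    = ∈⊤ , (λ _ _ → ∈⊤) , (λ _ → ∈⊤)
  S-subgroup (suc i) = D-subgroup (S i)

  2^i≤n : ∀ i → 2 ^ i * ∣ S i ∣ ≤ n → 2 ^ i ≤ n
  2^i≤n i bound = begin
    2 ^ i              ≡⟨ sym (*-identityʳ (2 ^ i)) ⟩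
    2 ^ i * 1          ≤⟨ *-monoʳ-≤ (2 ^ i) (x∈p⇒∣p∣>0 (proj₁ (S-subgroup i))) ⟩
    2 ^ i * ∣ S i ∣    ≤⟨ bound ⟩
    n                  ∎
    where open ≤-Reasoning

  trivial-or-2^i*∣Si∣≤n : ∀ i →
    (∃[ l ] (2 ^ l ≤ n × IsTrivial G (S l))) ⊎ (2 ^ i * ∣ S i ∣ ≤ n)
  trivial-or-2^i*∣Si∣≤n zero = inj₂ (≤-reflexive (trans (+-identityʳ _) (∣⊤∣≡n n)))
  trivial-or-2^i*∣Si∣≤n (suc i) with trivial-or-2^i*∣Si∣≤n i
  ... | inj₁ found = inj₁ found
  ... | inj₂ bound with trivial-or-nontrivial (proj₁ (S-subgroup i))
  ...   | inj₁ trivial = inj₁ (i , 2^i≤n i bound , trivial)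
  ...   | inj₂ (x , x∈Si , x≢e) = inj₂ (begin
    2 ^ suc i * a              ≡⟨ *-assoc 2 (2 ^ i) a ⟩
    2 ^ i * a + (2 ^ i * a + 0) ≡⟨ cong (2 ^ i * a +_) (+-identityʳ _) ⟩
    2 ^ i * a + 2 ^ i * a      ≡⟨ sym (*-distribˡ-+ (2 ^ i) a a) ⟩
    2 ^ i * (a + a)            ≤⟨ *-monoʳ-≤ (2 ^ i) (∣DH∣+∣DH∣≤∣H∣ (S-subgroup i) x∈Si x≢e) ⟩
    2 ^ i * ∣ S i ∣            ≤⟨ bound ⟩
    n                          ∎)
    where
    open ≤-Reasoning
    a : ℕ
    a = ∣ S (suc i) ∣

  S-eventuallyTrivial : ∃[ l ] (2 ^ l ≤ n × IsTrivial G (S l))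
  S-eventuallyTrivial with trivial-or-2^i*∣Si∣≤n n
  ... | inj₁ found = found
  ... | inj₂ bound = ⊥-elim (<⇒≱ (n<2^n n) (2^i≤n n bound))

lemma2p2 : (G : FiniteGroup) →
    ∃[ l ] (l ≤ ⌊log₂ order G ⌋ × DerivedTermTrivial G l)
lemma2p2 G with S-eventuallyTrivial G
... | l , 2^l≤∣G∣ , trivial =
  l , 2^l≤m⇒l≤⌊log₂m⌋ 2^l≤∣G∣ , S G , S-isGenDerivedSeries G , trivial
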